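{- Let $k,n$ be integers with $2\le k<n$. The game Nim$_{n,\le k}$ is miserable. Moreover, for a position $x=(x_1,\dots,x_n)$, letting $l$ be the number of indices $i$ with $x_i>0$: (a) $x$ is a $(0,1)$-position if and only if $x_i\le1$ for all $i$ and $l\equiv0\pmod{k+1}$; (b) $x$ is a $(1,0)$-position if and only if $x_i\le1$ for all $i$ and $l\equiv1\pmod{k+1}$.
   Context: Nim$_{n,\le k}$ (Moore's Nim): positions are $n$-tuples $(x_1,\dots,x_n)$ of non-negative integers; a move chooses at least one and at most $k$ piles and strictly decreases each chosen pile (each to any smaller non-negative value). $\operatorname{mex}(S)$ is the least non-negative integer not in $S$; the normal Sprague–Grundy function is $\mathcal{G}(x)=\operatorname{mex}\{\mathcal{G}(y): x\to y\}$ (so $0$ on terminal positions); the misère function $\mathcal{G}^-$ satisfies $\mathcal{G}^-(x)=1$ for terminal $x$ and $\mathcal{G}^-(x)=\operatorname{mex}\{\mathcal{G}^-(y): x\to y\}$ otherwise. An $(i,j)$-position is one with $\mathcal{G}=i$, $\mathcal{G}^-=j$; $V_{i,j}$ is the set of them. A position is movable to a set $W$ if it has a move to some position of $W$. A game is miserable if every position $x$ satisfies at least one of: (a) $x\in V_{0,1}\cup V_{1,0}$; (b) $x$ is not movable to $V_{0,1}\cup V_{1,0}$; (c) $x$ is movable to $V_{0,1}$ and to $V_{1,0}$. -}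

module Defs where

open import Data.Nat using (ℕ; zero; suc; _+_; _≤_; _<_; _≤?_; _≟_)
open import Data.Bool using (Bool; true; false; if_then_else_)
open import Data.List using (List; []; _∷_; map; concatMap; upTo; filter; length)
open import Data.List.Membership.DecPropositional _≟_ using (_∈?_)
open import Data.Vec using (Vec; []; _∷_; lookup)
open import Data.Fin using (Fin)
open import Data.Product using (_×_; Σ; ∃)
open import Data.Sum using (_⊎_)
open import Relation.Nullary using (¬_; does)
open import Relation.Binary.PropositionalEquality using (_≡_)

Position : ℕ → Set
Position n = Vec ℕ n

decreased : ∀ {n} → Position n → Position n → ℕ
decreased [] [] = 0
decreased (a ∷ x) (b ∷ y) = (if does (suc b ≤? a) then 1 else 0) + decreased x y

support : ∀ {n} → Position n → ℕ
support [] = 0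
support (a ∷ x) = (if does (1 ≤? a) then 1 else 0) + support x

-- A move x → y in Nim_{n,≤k}: every pile weakly decreases, and the number of
-- strictly decreased piles is between 1 and k (unchanged piles are not chosen).
Move : ℕ → ∀ {n} → Position n → Position n → Set
Move k x y = (∀ i → lookup y i ≤ lookup x i) × 1 ≤ decreased x y × decreased x y ≤ k

below : ∀ {n} → Position n → List (Position n)
below [] = [] ∷ []
below (a ∷ x) = concatMap (λ b → map (b ∷_) (below x)) (upTo (suc a))

options : ℕ → ∀ {n} → Position n → List (Position n)
options k x = filter (λ y → 1 ≤? decreased x y) (filter (λ y → decreased x y ≤? k) (below x))

mexAux : ℕ → ℕ → List ℕ → ℕ
mexAux zero m l = m
mexAux (suc f) m l = if does (m ∈? l) then mexAux f (suc m) l else m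

mex : List ℕ → ℕ
mex l = mexAux (length l) 0 l

sumV : ∀ {n} → Position n → ℕ
sumV [] = 0
sumV (a ∷ x) = a + sumV x

-- Grundy functions computed with fuel; fuel = sum of the piles suffices since
-- every move decreases the sum by at least one.
grundyF : ℕ → ℕ → ∀ {n} → Position n → ℕ
grundyF k zero x = 0
grundyF k (suc f) x = mex (map (grundyF k f) (options k x))

misereF : ℕ → ℕ → ∀ {n} → Position n → ℕ
misereF k zero x = 1
misereF k (suc f) x with options k x
... | [] = 1
... | o ∷ os = mex (map (misereF k f) (o ∷ os))

G : ℕ → ∀ {n} → Position n → ℕ
G k x = grundyF k (sumV x) x

G⁻ : ℕ → ∀ {n} → Position n → ℕ
G⁻ k x = misereF k (sumV x) x

V : ℕ → ∀ {n} → ℕ → ℕ → Position n → Set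
V k i j x = G k x ≡ i × G⁻ k x ≡ j

MovableTo : ℕ → ∀ {n} → (Position n → Set) → Position n → Set
MovableTo k W x = ∃ λ y → Move k x y × W y

V01∪V10 : ℕ → ∀ {n} → Position n → Set
V01∪V10 k x = V k 0 1 x ⊎ V k 1 0 x

Miserable : ℕ → ℕ → Set
Miserable k n = (x : Position n) →
  V01∪V10 k x
  ⊎ ¬ MovableTo k (V01∪V10 k) x
  ⊎ (MovableTo k (V k 0 1) x × MovableTo k (V k 1 0) x)

-- Call a position binary if all its piles are at most 1, and a pile big if it has
-- at least 2 tokens.  A move from a binary position removes between 1 and k tokens,
-- so it changes the support modulo k + 1 and can realise every smaller residue;
-- hence G is the support modulo k + 1 on binary positions.  By induction, G⁻ swaps
-- the values 0 and 1 on binary positions of residue 0 and 1 and agrees with G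
-- everywhere else.  The key point is that if any option of such an x is binary,
-- then x has at most k big piles; cutting each of them to 0 or 1 and possibly
-- emptying piles of size 1, x reaches binary positions of residue 0 and of residue 1
-- alike, so among the options the values 0 and 1 merely trade places and the mex
-- does not change.

module Submission where

open import Defs
open import Data.Bool using (true; false)
open import Data.Empty using (⊥-elim)
open import Data.Fin using (Fin; zero; suc; toℕ)
open import Data.Fin.Properties using (injective⇒≤; toℕ<n; toℕ-injective; all?)
open import Data.List using (List; []; _∷_; length; map; upTo)
import Data.List as List
open import Data.List.Properties using (map-cong-local)
open import Data.List.Membership.Propositional using (_∈_; _∉_; lose; find)
open import Data.List.Membership.Propositional.Properties
  using (∈-map⁺; ∈-map⁻; ∈-concatMap⁺; ∈-concatMap⁻; ∈-upTo⁺; ∈-upTo⁻; ∈-filter⁺; ∈-filter⁻)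
open import Data.List.Relation.Binary.Subset.Propositional using (_⊆_)
import Data.List.Relation.Unary.All as All
open import Data.List.Relation.Unary.Any as Any using (here)
open import Data.List.Relation.Unary.Any.Properties using (lookup-index)
open import Data.Nat
  using (ℕ; zero; suc; _+_; _*_; _∸_; _⊔_; _≤_; _<_; _%_; _/_; _≟_; _≤?_; _<ᵇ_; z≤n; s≤s; s≤s⁻¹)
open import Data.List.Membership.DecPropositional _≟_ using (_∈?_)
open import Data.Nat.Properties
open import Data.Nat.DivMod using (m≡m%n+[m/n]*n; [m+kn]%n≡m%n; m<n⇒m%n≡m; m%n<n; m%n≤m)
open import Data.Nat.Divisibility using (divides; ∣⇒≤; ∣m+n∣m⇒∣n; n∣m*n)
open import Data.Nat.Induction using (<-wellFounded)
open import Data.Nat.Tactic.RingSolver using (solve-∀)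
open import Data.Product using (_×_; _,_; proj₁; proj₂; ∃; ∃₂)
open import Data.Sum using (_⊎_; inj₁; inj₂)
open import Data.Vec using ([]; _∷_; lookup)
open import Function.Bundles using (_⇔_; mk⇔; module Equivalence)
import Induction.WellFounded as WF
import Relation.Binary.Construct.On as On
open import Relation.Binary.Definitions using (tri<; tri≈; tri>)
open import Relation.Nullary using (¬_; Dec; yes; no; ofʸ)
open import Relation.Nullary.Decidable using (_×-dec_; dec-true; dec-false)
open import Relation.Binary.PropositionalEquality

Covers : List ℕ → ℕ → Set
Covers l m = ∀ j → j < m → j ∈ l

covers⇒≤length : ∀ r (l : List ℕ) → Covers l r → r ≤ length l
covers⇒≤length r l cover = injective⇒≤ {f = position} position-injective
  where
  position : Fin r → Fin (length l)
  position i = Any.index (cover (toℕ i) (toℕ<n i))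

  position-injective : ∀ {i j} → position i ≡ position j → i ≡ j
  position-injective {i} {j} eq = toℕ-injective (begin
    toℕ i                       ≡⟨ lookup-index (cover (toℕ i) (toℕ<n i)) ⟩
    List.lookup l (position i)  ≡⟨ cong (List.lookup l) eq ⟩
    List.lookup l (position j)  ≡⟨ lookup-index (cover (toℕ j) (toℕ<n j)) ⟨
    toℕ j                       ∎)
    where open ≡-Reasoning

covers-suc : ∀ {l m} → Covers l m → m ∈ l → Covers l (suc m)
covers-suc cover m∈ j j<1+m with m≤n⇒m<n∨m≡n (s≤s⁻¹ j<1+m)
... | inj₁ j<m = cover j j<m
... | inj₂ refl = m∈

-- The fuel f + m = length l cannot run out before the mex is found: a list
-- covering all of 0 … length l would be longer than itself.
mexAux-spec : ∀ f m l → Covers l m → f + m ≡ length l →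
              Covers l (mexAux f m l) × mexAux f m l ∉ l
mexAux-spec zero m l cover eq =
  cover , λ m∈ → <-irrefl eq (covers⇒≤length (suc m) l (covers-suc cover m∈))
mexAux-spec (suc f) m l cover eq with m ∈? l
... | no m∉ = cover , m∉
... | yes m∈ = mexAux-spec f (suc m) l (covers-suc cover m∈) (trans (+-suc f m) eq)

mex-spec : ∀ l → Covers l (mex l) × mex l ∉ l
mex-spec l = mexAux-spec (length l) 0 l (λ _ ()) (+-identityʳ _)

mex-unique : ∀ {l r} → r ∉ l → Covers l r → mex l ≡ r
mex-unique {l} {r} r∉ cover with <-cmp (mex l) r
... | tri≈ _ eq _ = eq
... | tri< lt _ _ = ⊥-elim (proj₂ (mex-spec l) (cover _ lt))
... | tri> _ _ gt = ⊥-elim (r∉ (proj₁ (mex-spec l) r gt))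

mex-cong : ∀ {l₁ l₂} → l₁ ⊆ l₂ → l₂ ⊆ l₁ → mex l₁ ≡ mex l₂
mex-cong {l₁} {l₂} l₁⊆l₂ l₂⊆l₁ =
  mex-unique (λ m∈ → proj₂ (mex-spec l₂) (l₁⊆l₂ m∈)) (λ j j<m → l₂⊆l₁ (proj₁ (mex-spec l₂) j j<m))

_≤ᵥ_ : ∀ {n} → Position n → Position n → Set
y ≤ᵥ x = ∀ i → lookup y i ≤ lookup x i

≤ᵥ-refl : ∀ {n} (x : Position n) → x ≤ᵥ x
≤ᵥ-refl _ _ = ≤-refl

≤ᵥ-cons : ∀ {n a b} {x y : Position n} → b ≤ a → y ≤ᵥ x → (b ∷ y) ≤ᵥ (a ∷ x)
≤ᵥ-cons b≤a y≤x zero = b≤a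
≤ᵥ-cons b≤a y≤x (suc i) = y≤x i

≤ᵥ-tail : ∀ {n a b} {x y : Position n} → (b ∷ y) ≤ᵥ (a ∷ x) → y ≤ᵥ x
≤ᵥ-tail y≤x i = y≤x (suc i)

∈-below⁺ : ∀ {n} (x y : Position n) → y ≤ᵥ x → y ∈ below x
∈-below⁺ [] [] _ = here refl
∈-below⁺ (a ∷ x) (b ∷ y) y≤x =
  ∈-concatMap⁺ (λ c → map (c ∷_) (below x)) (lose (∈-upTo⁺ (s≤s (y≤x zero))) (∈-map⁺ (b ∷_) (∈-below⁺ x y (≤ᵥ-tail y≤x))))

∈-below⁻ : ∀ {n} (x y : Position n) → y ∈ below x → y ≤ᵥ x
∈-below⁻ [] [] _ ()
∈-below⁻ (a ∷ x) y y∈ with find (∈-concatMap⁻ (λ b → map (b ∷_) (below x)) {xs = upTo (suc a)} y∈)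
... | b , b∈ , y∈′ with ∈-map⁻ (b ∷_) y∈′
... | y′ , y′∈ , refl = ≤ᵥ-cons (s≤s⁻¹ (∈-upTo⁻ b∈)) (∈-below⁻ x y′ y′∈)

decreased-self : ∀ {n} (x : Position n) → decreased x x ≡ 0
decreased-self [] = refl
decreased-self (a ∷ x) rewrite dec-false (suc a ≤? a) (n≮n a) = decreased-self x

sumV-decreased : ∀ {n} (x y : Position n) → y ≤ᵥ x → sumV y + decreased x y ≤ sumV x
sumV-decreased [] [] _ = ≤-refl
sumV-decreased (a ∷ x) (b ∷ y) y≤x with b <ᵇ a | <ᵇ-reflects-< b a
... | true | ofʸ b<a = begin
  b + sumV y + suc (decreased x y)  ≡⟨ +-suc (b + sumV y) _ ⟩
  suc (b + sumV y + decreased x y)  ≡⟨ cong suc (+-assoc b (sumV y) _) ⟩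
  suc b + (sumV y + decreased x y)  ≤⟨ +-mono-≤ b<a (sumV-decreased x y (≤ᵥ-tail y≤x)) ⟩
  a + sumV x                        ∎
  where open ≤-Reasoning
... | false | _ = begin
  b + sumV y + decreased x y    ≡⟨ +-assoc b (sumV y) _ ⟩
  b + (sumV y + decreased x y)  ≤⟨ +-mono-≤ (y≤x zero) (sumV-decreased x y (≤ᵥ-tail y≤x)) ⟩
  a + sumV x                    ∎
  where open ≤-Reasoning

take-one : ∀ {n} (x : Position n) → 1 ≤ support x → ∃ λ y → y ≤ᵥ x × decreased x y ≡ 1
take-one (zero ∷ x) 1≤s with take-one x 1≤s
... | y , y≤x , d≡1 = zero ∷ y , ≤ᵥ-cons z≤n y≤x , d≡1
take-one (suc a ∷ x) _ = a ∷ x , ≤ᵥ-cons (n≤1+n a) (≤ᵥ-refl x) , one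
  where
  one : decreased (suc a ∷ x) (a ∷ x) ≡ 1
  one rewrite dec-true (suc a ≤? suc a) ≤-refl | decreased-self x = refl

module _ (k : ℕ) where

  ∈-options⁺ : ∀ {n} (x y : Position n) → Move k x y → y ∈ options k x
  ∈-options⁺ x y (y≤x , 1≤d , d≤k) =
    ∈-filter⁺ (λ y → 1 ≤? decreased x y) (∈-filter⁺ (λ y → decreased x y ≤? k) (∈-below⁺ x y y≤x) d≤k) 1≤d

  ∈-options⁻ : ∀ {n} (x y : Position n) → y ∈ options k x → Move k x y
  ∈-options⁻ x y y∈ =
    let (y∈′ , 1≤d) = ∈-filter⁻ (λ y → 1 ≤? decreased x y)
                        {xs = List.filter (λ y → decreased x y ≤? k) (below x)} y∈
        (y∈below , d≤k) = ∈-filter⁻ (λ y → decreased x y ≤? k) {xs = below x} y∈′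
    in ∈-below⁻ x y y∈below , 1≤d , d≤k

  move⇒sumV< : ∀ {n} (x y : Position n) → Move k x y → sumV y < sumV x
  move⇒sumV< x y (y≤x , 1≤d , _) = <-≤-trans (m<m+n (sumV y) 1≤d) (sumV-decreased x y y≤x)

  move-induction : ∀ {n} (P : Position n → Set) →
                   (∀ x → (∀ y → Move k x y → P y) → P x) → ∀ x → P x
  move-induction P step = WF.All.wfRec moves-wellFounded _ P (λ x ih → step x (λ y → ih {y}))
    where
    moves-wellFounded : WF.WellFounded (λ y x → Move k x y)
    moves-wellFounded = WF.Subrelation.wellFounded (λ {y} {x} → move⇒sumV< x y) (On.wellFounded sumV <-wellFounded)

  sumV≡0⇒options≡[] : ∀ {n} (x : Position n) → sumV x ≡ 0 → options k x ≡ []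
  sumV≡0⇒options≡[] x sumV≡0 with options k x in eq
  ... | [] = refl
  ... | y ∷ _ = ⊥-elim (n≮0 (subst (sumV y <_) sumV≡0 (move⇒sumV< x y (∈-options⁻ x y y∈))))
    where
    y∈ : y ∈ options k x
    y∈ = subst (y ∈_) (sym eq) (here refl)

  map-cong-options : ∀ {n} {f g : Position n → ℕ} (x : Position n) →
                     (∀ y → Move k x y → f y ≡ g y) → map f (options k x) ≡ map g (options k x)
  map-cong-options x f≡g = map-cong-local (All.tabulate (λ {y} y∈ → f≡g y (∈-options⁻ x y y∈)))

  grundyF-fuel : ∀ f g {n} (x : Position n) → sumV x ≤ f → sumV x ≤ g → grundyF k f x ≡ grundyF k g x
  grundyF-fuel zero zero x _ _ = refl
  grundyF-fuel zero (suc g) x p _ rewrite sumV≡0⇒options≡[] x (n≤0⇒n≡0 p) = refl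
  grundyF-fuel (suc f) zero x _ q rewrite sumV≡0⇒options≡[] x (n≤0⇒n≡0 q) = refl
  grundyF-fuel (suc f) (suc g) x p q = cong mex (map-cong-options x (λ y mv →
    grundyF-fuel f g y (s≤s⁻¹ (<-≤-trans (move⇒sumV< x y mv) p)) (s≤s⁻¹ (<-≤-trans (move⇒sumV< x y mv) q))))

  misereF-fuel : ∀ f g {n} (x : Position n) → sumV x ≤ f → sumV x ≤ g → misereF k f x ≡ misereF k g x
  misereF-fuel zero zero x _ _ = refl
  misereF-fuel zero (suc g) x p _ rewrite sumV≡0⇒options≡[] x (n≤0⇒n≡0 p) = refl
  misereF-fuel (suc f) zero x _ q rewrite sumV≡0⇒options≡[] x (n≤0⇒n≡0 q) = refl
  misereF-fuel (suc f) (suc g) x p q with options k x | map-cong-options x (λ y mv →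
    misereF-fuel f g y (s≤s⁻¹ (<-≤-trans (move⇒sumV< x y mv) p)) (s≤s⁻¹ (<-≤-trans (move⇒sumV< x y mv) q)))
  ... | [] | _ = refl
  ... | _ ∷ _ | same-values = cong mex same-values

  G-unfold : ∀ {n} (x : Position n) → G k x ≡ mex (map (G k) (options k x))
  G-unfold x = trans (grundyF-fuel (sumV x) (suc (sumV x)) x ≤-refl (n≤1+n _))
    (cong mex (map-cong-options x (λ y mv →
      grundyF-fuel (sumV x) (sumV y) y (≤-trans (n≤1+n _) (move⇒sumV< x y mv)) ≤-refl)))

  G⁻-unfold : ∀ {n} (x y : Position n) → Move k x y → G⁻ k x ≡ mex (map (G⁻ k) (options k x))
  G⁻-unfold x y mv = trans (misereF-fuel (sumV x) (suc (sumV x)) x ≤-refl (n≤1+n _)) unfolded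
    where
    unfolded : misereF k (suc (sumV x)) x ≡ mex (map (G⁻ k) (options k x))
    unfolded with options k x | ∈-options⁺ x y mv | map-cong-options x (λ y′ mv′ →
      misereF-fuel (sumV x) (sumV y′) y′ (≤-trans (n≤1+n _) (move⇒sumV< x y′ mv′)) ≤-refl)
    ... | [] | () | _
    ... | _ ∷ _ | _ | same-values = cong mex same-values

  G⁻-terminal : ∀ {n} (x : Position n) → (∀ y → ¬ Move k x y) → G⁻ k x ≡ 1
  G⁻-terminal x terminal = trans (misereF-fuel (sumV x) (suc (sumV x)) x ≤-refl (n≤1+n _)) no-options
    where
    no-options : misereF k (suc (sumV x)) x ≡ 1
    no-options with options k x in eq
    ... | [] = refl
    ... | y ∷ _ = ⊥-elim (terminal y (∈-options⁻ x y (subst (y ∈_) (sym eq) (here refl))))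

  mex-options : ∀ {n} (f : Position n → ℕ) (x : Position n) r →
                (∀ y → Move k x y → f y ≢ r) → (∀ j → j < r → ∃ λ y → Move k x y × f y ≡ j) →
                mex (map f (options k x)) ≡ r
  mex-options f x r missed reached = mex-unique r∉ covered
    where
    r∉ : r ∉ map f (options k x)
    r∉ r∈ with ∈-map⁻ f r∈
    ... | y , y∈ , r≡fy = missed y (∈-options⁻ x y y∈) (sym r≡fy)

    covered : Covers (map f (options k x)) r
    covered j j<r with reached j j<r
    ... | y , mv , fy≡j = subst (_∈ map f (options k x)) fy≡j (∈-map⁺ f (∈-options⁺ x y mv))

  map-options-⊆ : ∀ {n} (f g : Position n → ℕ) (x : Position n) →
                  (∀ y → Move k x y → ∃ λ y′ → Move k x y′ × g y′ ≡ f y) →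
                  map f (options k x) ⊆ map g (options k x)
  map-options-⊆ f g x matched j∈ with ∈-map⁻ f j∈
  ... | y , y∈ , refl with matched y (∈-options⁻ x y y∈)
  ... | y′ , mv′ , gy′≡fy = subst (_∈ map g (options k x)) gy′≡fy (∈-map⁺ g (∈-options⁺ x y′ mv′))

  mex-options-cong : ∀ {n} (f g : Position n → ℕ) (x : Position n) →
                     (∀ y → Move k x y → ∃ λ y′ → Move k x y′ × g y′ ≡ f y × f y′ ≡ g y) →
                     mex (map f (options k x)) ≡ mex (map g (options k x))
  mex-options-cong f g x exchange = mex-cong
    (map-options-⊆ f g x (λ y mv → let (y′ , mv′ , g≡f , _) = exchange y mv in y′ , mv′ , g≡f))
    (map-options-⊆ g f x (λ y mv → let (y′ , mv′ , _ , f≡g) = exchange y mv in y′ , mv′ , f≡g))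

Binary : ∀ {n} → Position n → Set
Binary x = ∀ i → lookup x i ≤ 1

binary? : ∀ {n} (x : Position n) → Dec (Binary x)
binary? x = all? (λ i → lookup x i ≤? 1)

binary-cons : ∀ {n a} {x : Position n} → a ≤ 1 → Binary x → Binary (a ∷ x)
binary-cons a≤1 _ zero = a≤1
binary-cons _ bin (suc i) = bin i

binary-tail : ∀ {n a} {x : Position n} → Binary (a ∷ x) → Binary x
binary-tail bin i = bin (suc i)

binary-≤ᵥ : ∀ {n} (x y : Position n) → Binary x → y ≤ᵥ x → Binary y
binary-≤ᵥ _ _ bin y≤x i = ≤-trans (y≤x i) (bin i)

support-decreased : ∀ {n} (x y : Position n) → Binary x → y ≤ᵥ x → support y + decreased x y ≡ support x
support-decreased [] [] _ _ = refl
support-decreased (a ∷ x) (b ∷ y) bin y≤x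
  with support-decreased x y (binary-tail bin) (≤ᵥ-tail y≤x) | bin zero | y≤x zero
... | eq | z≤n | z≤n = eq
... | eq | s≤s z≤n | z≤n = trans (+-suc _ _) (cong suc eq)
... | eq | s≤s z≤n | s≤s z≤n = cong suc eq

bigPiles : ∀ {n} → Position n → ℕ
bigPiles [] = 0
bigPiles (zero ∷ x) = bigPiles x
bigPiles (suc zero ∷ x) = bigPiles x
bigPiles (suc (suc _) ∷ x) = suc (bigPiles x)

bigPiles≤support : ∀ {n} (x : Position n) → bigPiles x ≤ support x
bigPiles≤support [] = z≤n
bigPiles≤support (zero ∷ x) = bigPiles≤support x
bigPiles≤support (suc zero ∷ x) = m≤n⇒m≤1+n (bigPiles≤support x)
bigPiles≤support (suc (suc _) ∷ x) = s≤s (bigPiles≤support x)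

bigPiles≤decreased : ∀ {n} (x y : Position n) → Binary y → y ≤ᵥ x → bigPiles x ≤ decreased x y
bigPiles≤decreased [] [] _ _ = z≤n
bigPiles≤decreased (zero ∷ x) (_ ∷ y) bin y≤x = bigPiles≤decreased x y (binary-tail bin) (≤ᵥ-tail y≤x)
bigPiles≤decreased (suc zero ∷ x) (_ ∷ y) bin y≤x =
  ≤-trans (bigPiles≤decreased x y (binary-tail bin) (≤ᵥ-tail y≤x)) (m≤n+m _ _)
bigPiles≤decreased (suc (suc _) ∷ x) (b ∷ y) bin y≤x with b | bin zero
... | zero | _ = s≤s (bigPiles≤decreased x y (binary-tail bin) (≤ᵥ-tail y≤x))
... | suc zero | _ = s≤s (bigPiles≤decreased x y (binary-tail bin) (≤ᵥ-tail y≤x))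
... | suc (suc _) | s≤s ()

binary⇒bigPiles≡0 : ∀ {n} (x : Position n) → Binary x → bigPiles x ≡ 0
binary⇒bigPiles≡0 x bin = n≤0⇒n≡0 (subst (bigPiles x ≤_) (decreased-self x) (bigPiles≤decreased x x bin (≤ᵥ-refl x)))

bigPiles≡0⇒binary : ∀ {n} (x : Position n) → bigPiles x ≡ 0 → Binary x
bigPiles≡0⇒binary [] _ ()
bigPiles≡0⇒binary (zero ∷ x) b≡0 = binary-cons z≤n (bigPiles≡0⇒binary x b≡0)
bigPiles≡0⇒binary (suc zero ∷ x) b≡0 = binary-cons ≤-refl (bigPiles≡0⇒binary x b≡0)

support≡0⇒binary : ∀ {n} (x : Position n) → support x ≡ 0 → Binary x
support≡0⇒binary x s≡0 = bigPiles≡0⇒binary x (n≤0⇒n≡0 (subst (bigPiles x ≤_) s≡0 (bigPiles≤support x)))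

-- Removing e tokens to reach a binary position: big piles are spent first (emptied
-- while e allows, otherwise cut to 1); piles of size 1 are emptied only for the
-- removals the remaining big piles cannot absorb.
binary-reduction : ∀ {n} (x : Position n) e → e ≤ support x →
  ∃ λ y → Binary y × y ≤ᵥ x × support y + e ≡ support x × decreased x y ≡ bigPiles x ⊔ e
binary-reduction [] zero _ = [] , (λ ()) , (λ ()) , refl , refl
binary-reduction (zero ∷ x) e e≤s with binary-reduction x e e≤s
... | y , bin , y≤x , s , d = zero ∷ y , binary-cons z≤n bin , ≤ᵥ-cons z≤n y≤x , s , d
binary-reduction (suc zero ∷ x) e e≤s with e ≤? bigPiles x
... | yes e≤b with binary-reduction x e (≤-trans e≤b (bigPiles≤support x))
...   | y , bin , y≤x , s , d = 1 ∷ y , binary-cons ≤-refl bin , ≤ᵥ-cons ≤-refl y≤x , cong suc s , d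
binary-reduction (suc zero ∷ x) zero _ | no 0≰b = ⊥-elim (0≰b z≤n)
binary-reduction (suc zero ∷ x) (suc e) e≤s | no e≰b with binary-reduction x e (s≤s⁻¹ e≤s)
... | y , bin , y≤x , s , d =
  zero ∷ y , binary-cons z≤n bin , ≤ᵥ-cons z≤n y≤x , trans (+-suc _ _) (cong suc s) , (begin
    suc (decreased x y)    ≡⟨ cong suc d ⟩
    suc (bigPiles x ⊔ e)   ≡⟨ cong suc (m≤n⇒m⊔n≡n b≤e) ⟩
    suc e                  ≡⟨ m≤n⇒m⊔n≡n (m≤n⇒m≤1+n b≤e) ⟨
    bigPiles x ⊔ suc e     ∎)
  where
  open ≡-Reasoning
  b≤e : bigPiles x ≤ e
  b≤e = s≤s⁻¹ (≰⇒> e≰b)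
binary-reduction (suc (suc _) ∷ x) zero _ with binary-reduction x zero z≤n
... | y , bin , y≤x , s , d =
  1 ∷ y , binary-cons ≤-refl bin , ≤ᵥ-cons (s≤s z≤n) y≤x , cong suc s , cong suc (trans d (⊔-identityʳ _))
binary-reduction (suc (suc _) ∷ x) (suc e) e≤s with binary-reduction x e (s≤s⁻¹ e≤s)
... | y , bin , y≤x , s , d =
  zero ∷ y , binary-cons z≤n bin , ≤ᵥ-cons z≤n y≤x , trans (+-suc _ _) (cong suc s) , cong suc d

module Residues (k : ℕ) where

  private
    K : ℕ
    K = suc k

  -- If t and t + d leave the same remainder then k + 1 divides d.
  residue-shift-≢ : ∀ t d → 1 ≤ d → d ≤ k → (t + d) % K ≢ t % K
  residue-shift-≢ t d@(suc _) _ d≤k same = <⇒≱ (s≤s d≤k) (∣⇒≤ K∣d)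
    where
    open ≡-Reasoning
    shifted : t % K + (t / K * K + d) ≡ t % K + (t + d) / K * K
    shifted = begin
      t % K + (t / K * K + d)        ≡⟨ +-assoc (t % K) _ d ⟨
      t % K + t / K * K + d          ≡⟨ cong (_+ d) (m≡m%n+[m/n]*n t K) ⟨
      t + d                          ≡⟨ m≡m%n+[m/n]*n (t + d) K ⟩
      (t + d) % K + (t + d) / K * K  ≡⟨ cong (_+ (t + d) / K * K) same ⟩
      t % K + (t + d) / K * K        ∎
    K∣d = ∣m+n∣m⇒∣n (divides ((t + d) / K) (+-cancelˡ-≡ (t % K) _ _ shifted)) (n∣m*n (t / K))

  [v+qK]%K≡v : ∀ v q → v ≤ k → (v + q * K) % K ≡ v
  [v+qK]%K≡v v q v≤k = trans ([m+kn]%n≡m%n v q K) (m<n⇒m%n≡m (s≤s v≤k))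

  -- From r + q (k + 1), residue v ≤ r is reached by removing r ∸ v tokens, and a
  -- residue v > r (which needs q ≥ 1) by removing r + (k + 1 ∸ v).
  residue-reachable : ∀ s v → v ≤ k → v ≤ s → ∃₂ λ t e → t + e ≡ s × e ≤ k × t % K ≡ v
  residue-reachable s v v≤k v≤s = subst (λ s → ∃₂ λ t e → t + e ≡ s × e ≤ k × t % K ≡ v)
    (sym (m≡m%n+[m/n]*n s K))
    (reach (s % K) (s / K) (s≤s⁻¹ (m%n<n s K)) (subst (v ≤_) (m≡m%n+[m/n]*n s K) v≤s))
    where
    reach : ∀ r q → r ≤ k → v ≤ r + q * K → ∃₂ λ t e → t + e ≡ r + q * K × e ≤ k × t % K ≡ v
    reach r q r≤k _ with v ≤? r
    ... | yes v≤r = v + q * K , r ∸ v , sum , ≤-trans (m∸n≤m r v) r≤k , [v+qK]%K≡v v q v≤k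
      where
      sum : v + q * K + (r ∸ v) ≡ r + q * K
      sum = begin
        v + q * K + (r ∸ v)    ≡⟨ +-right-swap v (q * K) (r ∸ v) ⟩
        v + (r ∸ v) + q * K    ≡⟨ cong (_+ q * K) (m+[n∸m]≡n v≤r) ⟩
        r + q * K              ∎
        where
        open ≡-Reasoning
        +-right-swap : ∀ a b c → a + b + c ≡ a + c + b
        +-right-swap = solve-∀
    reach r zero r≤k v≤s | no v≰r = ⊥-elim (v≰r (subst (v ≤_) (+-identityʳ r) v≤s))
    reach r (suc q) r≤k _ | no v≰r = v + q * K , r + (K ∸ v) , sum , e≤k , [v+qK]%K≡v v q v≤k
      where
      sum : v + q * K + (r + (K ∸ v)) ≡ r + suc q * K
      sum = begin
        v + q * K + (r + (K ∸ v))    ≡⟨ rearrange v (q * K) r (K ∸ v) ⟩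
        r + (v + (K ∸ v) + q * K)    ≡⟨ cong (λ m → r + (m + q * K)) (m+[n∸m]≡n (m≤n⇒m≤1+n v≤k)) ⟩
        r + suc q * K                ∎
        where
        open ≡-Reasoning
        rearrange : ∀ a b c d → a + b + (c + d) ≡ c + (a + d + b)
        rearrange = solve-∀
      e≤k : r + (K ∸ v) ≤ k
      e≤k = begin
        r + (K ∸ v)        ≡⟨ cong (r +_) (+-∸-assoc 1 v≤k) ⟩
        r + suc (k ∸ v)    ≡⟨ +-suc r (k ∸ v) ⟩
        suc r + (k ∸ v)    ≤⟨ +-monoˡ-≤ (k ∸ v) (≰⇒> v≰r) ⟩
        v + (k ∸ v)        ≡⟨ m+[n∸m]≡n v≤k ⟩
        k                  ∎
        where open ≤-Reasoning

module Characterisation (k : ℕ) (1≤k : 1 ≤ k) where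

  open Residues k

  private
    K : ℕ
    K = suc k

  Residue : ∀ {n} → ℕ → Position n → Set
  Residue v x = Binary x × support x % K ≡ v

  residue? : ∀ {n} v (x : Position n) → Dec (Residue v x)
  residue? v x = binary? x ×-dec (support x % K ≟ v)

  ¬Residue0⇒1≤support : ∀ {n} (x : Position n) → ¬ Residue 0 x → 1 ≤ support x
  ¬Residue0⇒1≤support x ¬res₀ = n≢0⇒n>0 (λ s≡0 → ¬res₀ (support≡0⇒binary x s≡0 , cong (_% K) s≡0))

  terminal-if-empty : ∀ {n} (x : Position n) → support x ≡ 0 → ∀ y → ¬ Move k x y
  terminal-if-empty x s≡0 y (y≤x , 1≤d , _) = n≮0 (<-≤-trans 1≤d d≤0)
    where
    d≤0 : decreased x y ≤ 0
    d≤0 = subst (decreased x y ≤_) (trans (support-decreased x y (support≡0⇒binary x s≡0) y≤x) s≡0) (m≤n+m _ _)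

  move-from-binary : ∀ {n} (x y : Position n) → Binary x → Move k x y →
                     Binary y × support y % K ≢ support x % K
  move-from-binary x y bin (y≤x , 1≤d , d≤k) =
    binary-≤ᵥ x y bin y≤x ,
    λ same → residue-shift-≢ (support y) (decreased x y) 1≤d d≤k (trans (cong (_% K) (support-decreased x y bin y≤x)) (sym same))

  reach-residue : ∀ {n} (x : Position n) v → bigPiles x ≤ k → v ≤ k → v ≤ support x → ¬ Residue v x →
                  ∃ λ y → Move k x y × Residue v y
  reach-residue x v b≤k v≤k v≤s ¬res with residue-reachable (support x) v v≤k v≤s
  ... | t , e , t+e≡s , e≤k , t%K≡v with binary-reduction x e (subst (e ≤_) t+e≡s (m≤n+m e t))
  ... | y , bin , y≤x , sy+e≡s , d≡ =
    y , (y≤x , subst (1 ≤_) (sym d≡) (positive (e ≟ 0) (bigPiles x ≟ 0)) , subst (_≤ k) (sym d≡) (⊔-lub b≤k e≤k)) ,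
    bin , trans (cong (_% K) (+-cancelʳ-≡ e _ _ (trans sy+e≡s (sym t+e≡s)))) t%K≡v
    where
    positive : Dec (e ≡ 0) → Dec (bigPiles x ≡ 0) → 1 ≤ bigPiles x ⊔ e
    positive (no e≢0) _ = ≤-trans (n≢0⇒n>0 e≢0) (m≤n⊔m _ e)
    positive _ (no b≢0) = ≤-trans (n≢0⇒n>0 b≢0) (m≤m⊔n _ e)
    positive (yes refl) (yes b≡0) =
      ⊥-elim (¬res (bigPiles≡0⇒binary x b≡0 , subst (λ s → s % K ≡ v) (trans (sym (+-identityʳ t)) t+e≡s) t%K≡v))

  reach-residue-from-binary : ∀ {n} (x : Position n) v → Binary x → v ≤ k → v ≤ support x → support x % K ≢ v →
                              ∃ λ y → Move k x y × Residue v y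
  reach-residue-from-binary x v bin v≤k v≤s r≢v =
    reach-residue x v (subst (_≤ k) (sym (binary⇒bigPiles≡0 x bin)) z≤n) v≤k v≤s (λ (_ , r≡v) → r≢v r≡v)

  reach-both : ∀ {n} (x : Position n) → ¬ Residue 0 x → ¬ Residue 1 x → bigPiles x ≤ k →
               (∃ λ y → Move k x y × Residue 0 y) × (∃ λ y → Move k x y × Residue 1 y)
  reach-both x ¬res₀ ¬res₁ b≤k =
    reach-residue x 0 b≤k z≤n z≤n ¬res₀ , reach-residue x 1 b≤k 1≤k (¬Residue0⇒1≤support x ¬res₀) ¬res₁

  record Values {n} (x : Position n) : Set where
    field
      G-binary     : Binary x → G k x ≡ support x % K
      G⁻-residue₀  : Residue 0 x → G⁻ k x ≡ 1
      G⁻-residue₁  : Residue 1 x → G⁻ k x ≡ 0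
      G⁻-otherwise : ¬ Residue 0 x → ¬ Residue 1 x → G⁻ k x ≡ G k x

    G-residue : ∀ {v} → Residue v x → G k x ≡ v
    G-residue (bin , r≡v) = trans (G-binary bin) r≡v

    G⁻≡1⇒residue₀ : Binary x → G⁻ k x ≡ 1 → support x % K ≡ 0
    G⁻≡1⇒residue₀ bin G⁻≡1 with residue? 0 x | residue? 1 x
    ... | yes (_ , r≡0) | _ = r≡0
    ... | no _ | yes res₁ = ⊥-elim (0≢1+n (trans (sym (G⁻-residue₁ res₁)) G⁻≡1))
    ... | no ¬res₀ | no ¬res₁ = ⊥-elim (¬res₁ (bin , trans (sym (G-binary bin)) (trans (sym (G⁻-otherwise ¬res₀ ¬res₁)) G⁻≡1)))

    G⁻≡0⇒residue₁ : Binary x → G⁻ k x ≡ 0 → support x % K ≡ 1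
    G⁻≡0⇒residue₁ bin G⁻≡0 with residue? 0 x | residue? 1 x
    ... | _ | yes (_ , r≡1) = r≡1
    ... | yes res₀ | no _ = ⊥-elim (0≢1+n (trans (sym G⁻≡0) (G⁻-residue₀ res₀)))
    ... | no ¬res₀ | no ¬res₁ = ⊥-elim (¬res₀ (bin , trans (sym (G-binary bin)) (trans (sym (G⁻-otherwise ¬res₀ ¬res₁)) G⁻≡0)))

  open Values

  ValuesOfOptions : ∀ {n} → Position n → Set
  ValuesOfOptions x = ∀ y → Move k x y → Values y

  G-binary-step : ∀ {n} (x : Position n) → ValuesOfOptions x → Binary x → G k x ≡ support x % K
  G-binary-step x ih bin = trans (G-unfold k x) (mex-options k (G k) x r missed reached)
    where
    r = support x % K
    missed : ∀ y → Move k x y → G k y ≢ r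
    missed y mv Gy≡r =
      let (bin-y , changed) = move-from-binary x y bin mv
      in changed (trans (sym (G-binary (ih y mv) bin-y)) Gy≡r)
    reached : ∀ j → j < r → ∃ λ y → Move k x y × G k y ≡ j
    reached j j<r =
      let (y , mv , res) = reach-residue-from-binary x j bin (≤-trans (<⇒≤ j<r) (s≤s⁻¹ (m%n<n (support x) K)))
                             (≤-trans (<⇒≤ j<r) (m%n≤m (support x) K)) (λ r≡j → <⇒≢ j<r (sym r≡j))
      in y , mv , G-residue (ih y mv) res

  G⁻-residue₀-step : ∀ {n} (x : Position n) → ValuesOfOptions x → Residue 0 x → G⁻ k x ≡ 1
  G⁻-residue₀-step x ih (bin , r≡0) = by-support (support x ≟ 0)
    where
    missed : ∀ y → Move k x y → G⁻ k y ≢ 1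
    missed y mv G⁻y≡1 =
      let (bin-y , changed) = move-from-binary x y bin mv
      in changed (trans (G⁻≡1⇒residue₀ (ih y mv) bin-y G⁻y≡1) (sym r≡0))

    through : (∃ λ y → Move k x y × Residue 1 y) → G⁻ k x ≡ 1
    through (y₀ , mv₀ , res₀) = trans (G⁻-unfold k x y₀ mv₀) (mex-options k (G⁻ k) x 1 missed reached)
      where
      reached : ∀ j → j < 1 → ∃ λ y → Move k x y × G⁻ k y ≡ j
      reached zero _ = y₀ , mv₀ , G⁻-residue₁ (ih y₀ mv₀) res₀
      reached (suc _) (s≤s ())

    by-support : Dec (support x ≡ 0) → G⁻ k x ≡ 1
    by-support (yes s≡0) = G⁻-terminal k x (terminal-if-empty x s≡0)
    by-support (no s≢0) =
      through (reach-residue-from-binary x 1 bin 1≤k (n≢0⇒n>0 s≢0) (λ r≡1 → 0≢1+n (trans (sym r≡0) r≡1)))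

  G⁻-residue₁-step : ∀ {n} (x : Position n) → ValuesOfOptions x → Residue 1 x → G⁻ k x ≡ 0
  G⁻-residue₁-step x ih (bin , r≡1) =
    through (reach-residue-from-binary x 0 bin z≤n z≤n (λ r≡0 → 0≢1+n (trans (sym r≡0) r≡1)))
    where
    missed : ∀ y → Move k x y → G⁻ k y ≢ 0
    missed y mv G⁻y≡0 =
      let (bin-y , changed) = move-from-binary x y bin mv
      in changed (trans (G⁻≡0⇒residue₁ (ih y mv) bin-y G⁻y≡0) (sym r≡1))

    through : (∃ λ y → Move k x y × Residue 0 y) → G⁻ k x ≡ 0
    through (y₀ , mv₀ , _) = trans (G⁻-unfold k x y₀ mv₀) (mex-options k (G⁻ k) x 0 missed (λ _ ()))

  G⁻-otherwise-step : ∀ {n} (x : Position n) → ValuesOfOptions x →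
                      ¬ Residue 0 x → ¬ Residue 1 x → G⁻ k x ≡ G k x
  G⁻-otherwise-step x ih ¬res₀ ¬res₁ with take-one x (¬Residue0⇒1≤support x ¬res₀)
  ... | y₀ , y₀≤x , d≡1 =
    trans (G⁻-unfold k x y₀ mv₀)
      (trans (mex-options-cong k (G⁻ k) (G k) x exchange)
        (sym (G-unfold k x)))
    where
    mv₀ : Move k x y₀
    mv₀ = y₀≤x , subst (1 ≤_) (sym d≡1) ≤-refl , subst (_≤ k) (sym d≡1) 1≤k

    Exchanged : Position _ → Set
    Exchanged y = ∃ λ y′ → Move k x y′ × G k y′ ≡ G⁻ k y × G⁻ k y′ ≡ G k y

    -- An option in residue 0 or 1 is binary, so x also reaches the other residue.
    exchange : ∀ y → Move k x y → Exchanged y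
    exchange y mv@(y≤x , _ , d≤k) = by-residue (residue? 0 y) (residue? 1 y)
      where
      both : Binary y → (∃ λ y′ → Move k x y′ × Residue 0 y′) × (∃ λ y′ → Move k x y′ × Residue 1 y′)
      both bin = reach-both x ¬res₀ ¬res₁ (≤-trans (bigPiles≤decreased x y bin y≤x) d≤k)

      by-residue : Dec (Residue 0 y) → Dec (Residue 1 y) → Exchanged y
      by-residue (yes res₀′) _ =
        let (y′ , mv′ , res₁′) = proj₂ (both (proj₁ res₀′))
        in y′ , mv′ , trans (G-residue (ih y′ mv′) res₁′) (sym (G⁻-residue₀ (ih y mv) res₀′)) ,
                      trans (G⁻-residue₁ (ih y′ mv′) res₁′) (sym (G-residue (ih y mv) res₀′))
      by-residue (no _) (yes res₁′) =
        let (y′ , mv′ , res₀′) = proj₁ (both (proj₁ res₁′))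
        in y′ , mv′ , trans (G-residue (ih y′ mv′) res₀′) (sym (G⁻-residue₁ (ih y mv) res₁′)) ,
                      trans (G⁻-residue₀ (ih y′ mv′) res₀′) (sym (G-residue (ih y mv) res₁′))
      by-residue (no ¬res₀′) (no ¬res₁′) =
        y , mv , sym (G⁻-otherwise (ih y mv) ¬res₀′ ¬res₁′) , G⁻-otherwise (ih y mv) ¬res₀′ ¬res₁′

  values : ∀ {n} (x : Position n) → Values x
  values = move-induction k Values λ x ih → record
    { G-binary     = G-binary-step x ih
    ; G⁻-residue₀  = G⁻-residue₀-step x ih
    ; G⁻-residue₁  = G⁻-residue₁-step x ih
    ; G⁻-otherwise = G⁻-otherwise-step x ih
    }

  V01⇔Residue0 : ∀ {n} (x : Position n) → V k 0 1 x ⇔ Residue 0 x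
  V01⇔Residue0 x = mk⇔ to (λ res₀ → G-residue (values x) res₀ , G⁻-residue₀ (values x) res₀)
    where
    to : V k 0 1 x → Residue 0 x
    to (G≡0 , G⁻≡1) with residue? 0 x | residue? 1 x
    ... | yes res₀ | _ = res₀
    ... | no _ | yes res₁ = ⊥-elim (0≢1+n (trans (sym G≡0) (G-residue (values x) res₁)))
    ... | no ¬res₀ | no ¬res₁ = ⊥-elim (0≢1+n (trans (sym G≡0) (trans (sym (G⁻-otherwise (values x) ¬res₀ ¬res₁)) G⁻≡1)))

  V10⇔Residue1 : ∀ {n} (x : Position n) → V k 1 0 x ⇔ Residue 1 x
  V10⇔Residue1 x = mk⇔ to (λ res₁ → G-residue (values x) res₁ , G⁻-residue₁ (values x) res₁)
    where
    to : V k 1 0 x → Residue 1 x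
    to (G≡1 , G⁻≡0) with residue? 0 x | residue? 1 x
    ... | _ | yes res₁ = res₁
    ... | yes res₀ | no _ = ⊥-elim (0≢1+n (trans (sym (G-residue (values x) res₀)) G≡1))
    ... | no ¬res₀ | no ¬res₁ = ⊥-elim (0≢1+n (trans (sym G⁻≡0) (trans (G⁻-otherwise (values x) ¬res₀ ¬res₁) G≡1)))

  miserable : ∀ n → Miserable k n
  miserable n x = classify (residue? 0 x) (residue? 1 x)
    where
    -- Every position in V01 ∪ V10 is binary, so reaching one decreases all big piles.
    unreachable : ¬ bigPiles x ≤ k → ¬ MovableTo k (V01∪V10 k) x
    unreachable b≰k (y , (y≤x , _ , d≤k) , inj₁ v01) =
      b≰k (≤-trans (bigPiles≤decreased x y (proj₁ (Equivalence.to (V01⇔Residue0 y) v01)) y≤x) d≤k)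
    unreachable b≰k (y , (y≤x , _ , d≤k) , inj₂ v10) =
      b≰k (≤-trans (bigPiles≤decreased x y (proj₁ (Equivalence.to (V10⇔Residue1 y) v10)) y≤x) d≤k)

    classify : Dec (Residue 0 x) → Dec (Residue 1 x) →
               V01∪V10 k x ⊎ ¬ MovableTo k (V01∪V10 k) x ⊎ (MovableTo k (V k 0 1) x × MovableTo k (V k 1 0) x)
    classify (yes res₀) _ = inj₁ (inj₁ (Equivalence.from (V01⇔Residue0 x) res₀))
    classify (no _) (yes res₁) = inj₁ (inj₂ (Equivalence.from (V10⇔Residue1 x) res₁))
    classify (no ¬res₀) (no ¬res₁) with bigPiles x ≤? k
    ... | no b≰k = inj₂ (inj₁ (unreachable b≰k))
    ... | yes b≤k =
      let ((y₀ , mv₀ , res₀) , (y₁ , mv₁ , res₁)) = reach-both x ¬res₀ ¬res₁ b≤k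
      in inj₂ (inj₂ ((y₀ , mv₀ , Equivalence.from (V01⇔Residue0 y₀) res₀) ,
                     (y₁ , mv₁ , Equivalence.from (V10⇔Residue1 y₁) res₁)))

proposition6p19 : (k n : ℕ) → 2 ≤ k → k < n →
    Miserable k n
    × ((x : Position n) →
        (V k 0 1 x ⇔ ((∀ i → lookup x i ≤ 1) × support x % suc k ≡ 0))
        × (V k 1 0 x ⇔ ((∀ i → lookup x i ≤ 1) × support x % suc k ≡ 1)))
proposition6p19 k n 2≤k _ = miserable n , λ x → V01⇔Residue0 x , V10⇔Residue1 x
  where open Characterisation k (≤-trans (s≤s z≤n) 2≤k)
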